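{- Let $f:\{0,1\}^n\to\{0,1\}$ be an arbitrary symmetric Boolean function. Then \[ \mathsf{N}(f)\ge\frac{\operatorname{alt}(f)}{2}. \]
   Context: $f$ is symmetric if $f(x)$ depends only on the Hamming weight $|x|$. $\mathsf{N}(f)$ is the minimum degree of a real polynomial $p$ with $|p(x)|\le 1/3$ whenever $f(x)=0$ and $|p(x)|\ge 1$ whenever $f(x)=1$. A monotone path is a sequence $x^{(1)},\dots,x^{(m)}\in\{0,1\}^n$ where each $x^{(i+1)}$ is obtained from $x^{(i)}$ by changing exactly one coordinate from $0$ to $1$; its alternation number is the number of $i$ with $f(x^{(i)})\ne f(x^{(i+1)})$; $\operatorname{alt}(f)$ is the maximum alternation number over monotone paths from $0^n$ to $1^n$. -}

module Defs where

open import Level using (0ℓ)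
open import Data.Nat using (ℕ; zero; suc) renaming (_+_ to _+ℕ_; _≤_ to _≤ℕ_)
open import Data.Bool using (Bool; true; false; _xor_)
open import Data.Fin using (Fin; zero; suc; fromℕ; inject₁)
open import Data.List using (List; []; _∷_)
open import Data.Product using (_×_; _,_; ∃)
open import Data.Sum using (_⊎_)
open import Relation.Binary.PropositionalEquality using (_≡_)
open import Relation.Nullary using (¬_)
open import Algebra.Structures using (IsCommutativeRing)
open import Relation.Binary.Structures using (IsTotalOrder)

Cube : ℕ → Set
Cube n = Fin n → Bool

sumFinℕ : (n : ℕ) → (Fin n → ℕ) → ℕ
sumFinℕ zero    g = 0
sumFinℕ (suc n) g = g zero +ℕ sumFinℕ n (λ i → g (suc i))

b2n : Bool → ℕ
b2n true  = 1
b2n false = 0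

weight : {n : ℕ} → Cube n → ℕ
weight {n} x = sumFinℕ n (λ i → b2n (x i))

Symmetric : {n : ℕ} → (Cube n → Bool) → Set
Symmetric {n} f = (x y : Cube n) → weight x ≡ weight y → f x ≡ f y

Step : {n : ℕ} → Cube n → Cube n → Set
Step {n} x y = ∃ λ (i : Fin n) →
  (x i ≡ false) × (y i ≡ true) × ((j : Fin n) → ¬ (j ≡ i) → x j ≡ y j)

MonotonePath : {n : ℕ} (m : ℕ) → (Fin (suc m) → Cube n) → Set
MonotonePath {n} m P =
  ((i : Fin n) → P zero i ≡ false) ×
  ((i : Fin n) → P (fromℕ m) i ≡ true) ×
  ((k : Fin m) → Step (P (inject₁ k)) (P (suc k)))

alternations : {n : ℕ} (f : Cube n → Bool) (m : ℕ) → (Fin (suc m) → Cube n) → ℕ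
alternations f m P = sumFinℕ m (λ k → b2n (f (P (inject₁ k)) xor f (P (suc k))))

-- The real numbers, given axiomatically as a Dedekind-complete ordered field
-- (unique up to isomorphism), since agda-stdlib has no reals.
record RealNumbers : Set₁ where
  infixl 6 _+_
  infixl 7 _*_
  field
    ℝ : Set
    _+_ _*_ : ℝ → ℝ → ℝ
    -_ : ℝ → ℝ
    0ℝ 1ℝ : ℝ
    _≤_ : ℝ → ℝ → Set
    isCommutativeRing : IsCommutativeRing _≡_ _+_ _*_ -_ 0ℝ 1ℝ
    0≢1 : ¬ (0ℝ ≡ 1ℝ)
    inverse : (x : ℝ) → ¬ (x ≡ 0ℝ) → ∃ λ y → x * y ≡ 1ℝ
    isTotalOrder : IsTotalOrder _≡_ _≤_
    +-mono-≤ : (x y z : ℝ) → x ≤ y → (x + z) ≤ (y + z)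
    *-nonneg : (x y : ℝ) → 0ℝ ≤ x → 0ℝ ≤ y → 0ℝ ≤ (x * y)
    lub : (S : ℝ → Set) → ∃ S → (∃ λ b → (x : ℝ) → S x → x ≤ b) →
          ∃ λ s → ((x : ℝ) → S x → x ≤ s) ×
                  ((b : ℝ) → ((x : ℝ) → S x → x ≤ b) → s ≤ b)

module Poly (R : RealNumbers) where
  open RealNumbers R

  -- A real polynomial in n variables: a finite list of terms c · ∏ x_i^{e_i}
  Polynomial : ℕ → Set
  Polynomial n = List (ℝ × (Fin n → ℕ))

  b2r : Bool → ℝ
  b2r true  = 1ℝ
  b2r false = 0ℝ

  pow : ℝ → ℕ → ℝ
  pow a zero    = 1ℝ
  pow a (suc k) = a * pow a k

  prodFin : (n : ℕ) → (Fin n → ℝ) → ℝ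
  prodFin zero    g = 1ℝ
  prodFin (suc n) g = g zero * prodFin n (λ i → g (suc i))

  evalPoly : {n : ℕ} → Polynomial n → Cube n → ℝ
  evalPoly []             x = 0ℝ
  evalPoly {n} ((c , e) ∷ t) x = c * prodFin n (λ i → pow (b2r (x i)) (e i)) + evalPoly t x

  DegreeAtMost : {n : ℕ} → Polynomial n → ℕ → Set
  DegreeAtMost []             d = Data.Unit.⊤ where import Data.Unit
  DegreeAtMost {n} ((c , e) ∷ t) d = (sumFinℕ n e ≤ℕ d) × DegreeAtMost t d

  three : ℝ
  three = 1ℝ + 1ℝ + 1ℝ

  -- p witnesses N(f) ≤ deg p:
  --   f x = 0  ⇒ |p x| ≤ 1/3   (written as  -1 ≤ 3·p(x) ≤ 1)
  --   f x = 1  ⇒ |p x| ≥ 1     (written as  p(x) ≥ 1 or p(x) ≤ -1)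
  NRepresents : {n : ℕ} → (Cube n → Bool) → Polynomial n → Set
  NRepresents {n} f p = (x : Cube n) →
    (f x ≡ false → ((- 1ℝ) ≤ (three * evalPoly p x)) × ((three * evalPoly p x) ≤ 1ℝ)) ×
    (f x ≡ true  → (1ℝ ≤ evalPoly p x) ⊎ (evalPoly p x ≤ (- 1ℝ)))

-- From p one builds q = (3p)² - 2, of degree 2d, which is negative where f = 0 and positive where
-- f = 1. Summing q over the level |x| = k with weight k! (n - k)! gives a sequence in k whose
-- (2d+1)-st differences vanish on 0, …, n, because a monomial in s variables contributes a multiple of
-- the binomial coefficient C(k, s). For symmetric f this sequence has the sign of f(x⁽ᵏ⁾) along any
-- monotone path, so it changes sign alt(f) times. By a discrete Rolle theorem a sequence with j sign
-- changes has a nonzero j-th difference in the same range, whence alt(f) ≤ 2d.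

module Submission where

open import Defs
open import Data.Bool using (Bool; true; false; not; _xor_)
open import Data.Empty using (⊥; ⊥-elim)
open import Data.Fin using (Fin; zero; suc; toℕ; inject₁)
open import Data.Nat as ℕ using (ℕ; zero; suc; z≤n; s≤s; _!; _∸_)
open import Data.Nat.Combinatorics using (_C_)
open import Data.List using ([]; _∷_)
import Data.Nat.Properties as ℕₚ
open import Data.Product using (∃; ∃₂; _×_; _,_; proj₁; proj₂)
open import Data.Sum using (_⊎_; inj₁; inj₂; [_,_]′; swap)
open import Function using (_∘_; id; case_of_)
import Data.Vec.Functional as Vec
open import Relation.Binary.PropositionalEquality

module FiniteSums where

  open import Data.Nat using (_+_; _≤_)
  open import Algebra.Properties.CommutativeSemigroup ℕₚ.+-commutativeSemigroup using (interchange)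

  sumFinℕ-cong : ∀ {n} {g h : Fin n → ℕ} → (∀ i → g i ≡ h i) → sumFinℕ n g ≡ sumFinℕ n h
  sumFinℕ-cong {zero}  g≗h = refl
  sumFinℕ-cong {suc n} g≗h = cong₂ _+_ (g≗h zero) (sumFinℕ-cong (g≗h ∘ suc))

  sumFinℕ-mono : ∀ {n} {g h : Fin n → ℕ} → (∀ i → g i ≤ h i) → sumFinℕ n g ≤ sumFinℕ n h
  sumFinℕ-mono {zero}  g≤h = z≤n
  sumFinℕ-mono {suc n} g≤h = ℕₚ.+-mono-≤ (g≤h zero) (sumFinℕ-mono (g≤h ∘ suc))

  sumFinℕ-+ : ∀ {n} (g h : Fin n → ℕ) → sumFinℕ n (λ i → g i + h i) ≡ sumFinℕ n g + sumFinℕ n h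
  sumFinℕ-+ {zero}  g h = refl
  sumFinℕ-+ {suc n} g h = trans (cong (g zero + h zero +_) (sumFinℕ-+ (g ∘ suc) (h ∘ suc)))
                                (interchange (g zero) (h zero) _ _)

  sumFinℕ-const : ∀ n c → sumFinℕ n (λ _ → c) ≡ n ℕ.* c
  sumFinℕ-const zero    c = refl
  sumFinℕ-const (suc n) c = cong (c +_) (sumFinℕ-const n c)

open FiniteSums

module Binomials where

  open import Data.Nat.Combinatorics
    using (nCk≡n!/k![n-k]!; k![n∸k]!∣n!; nCk+nC[k+1]≡[n+1]C[k+1]; k>n⇒nCk≡0)
  open import Data.Nat.DivMod using (m/n*n≡m)
  open import Data.Nat.Tactic.RingSolver using (solve-∀)
  open import Data.Nat using (_+_; _*_; _≤_; _<_)
  open ≡-Reasoning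

  C-factorial : ∀ {n k} → k ≤ n → (n C k) * (k ! * (n ∸ k) !) ≡ n !
  C-factorial {n} {k} k≤n =
    trans (cong (_* (k ! * (n ∸ k) !)) (nCk≡n!/k![n-k]! k≤n)) (m/n*n≡m (k![n∸k]!∣n! k≤n))
    where instance _ = ℕₚ._!*_!≢0 k (n ∸ k)

  C-absorption : ∀ k s → suc s * (suc k C suc s) ≡ suc k * (k C s)
  C-absorption k s with ℕₚ.≤-<-connex s k
  ... | inj₂ k<s = begin
    suc s * (suc k C suc s) ≡⟨ cong (suc s *_) (k>n⇒nCk≡0 (s≤s k<s)) ⟩
    suc s * 0               ≡⟨ ℕₚ.*-zeroʳ (suc s) ⟩
    0                       ≡⟨ ℕₚ.*-zeroʳ (suc k) ⟨
    suc k * 0               ≡⟨ cong (suc k *_) (k>n⇒nCk≡0 k<s) ⟨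
    suc k * (k C s)         ∎
  ... | inj₁ s≤k = ℕₚ.*-cancelʳ-≡ _ _ (s ! * (k ∸ s) !) (begin
    suc s * (suc k C suc s) * (s ! * (k ∸ s) !) ≡⟨ rearrange (suc k C suc s) s (s !) ((k ∸ s) !) ⟩
    (suc k C suc s) * (suc s ! * (k ∸ s) !)        ≡⟨ C-factorial (s≤s s≤k) ⟩
    suc k * k !                                   ≡⟨ cong (suc k *_) (C-factorial s≤k) ⟨
    suc k * ((k C s) * (s ! * (k ∸ s) !))        ≡⟨ ℕₚ.*-assoc (suc k) (k C s) (s ! * (k ∸ s) !) ⟨
    suc k * (k C s) * (s ! * (k ∸ s) !)          ∎)
    where
    instance _ = ℕₚ._!*_!≢0 s (k ∸ s)
    rearrange : ∀ c s f r → (1 + s) * c * (f * r) ≡ c * ((1 + s) * f * r)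
    rearrange = solve-∀

  -- The number of k-subsets of an n-set containing a fixed s-subset, i.e. C(n - s, k - s).
  supersets : ℕ → ℕ → ℕ → ℕ
  supersets n       zero    k       = n C k
  supersets zero    (suc s) k       = 0
  supersets (suc n) (suc s) zero    = 0
  supersets (suc n) (suc s) (suc k) = supersets n s k

  supersets-zero : ∀ n s → supersets (suc n) s 0 ≡ supersets n s 0
  supersets-zero n       zero    = refl
  supersets-zero zero    (suc s) = refl
  supersets-zero (suc n) (suc s) = refl

  supersets-pascal : ∀ {n s} k → s ≤ n → supersets (suc n) s (suc k) ≡ supersets n s (suc k) + supersets n s k
  supersets-pascal {n} {zero} k _ =
    trans (sym (nCk+nC[k+1]≡[n+1]C[k+1] n k)) (ℕₚ.+-comm (n C k) (n C suc k))
  supersets-pascal {suc n} {suc s} zero    _         = trans (supersets-zero n s) (sym (ℕₚ.+-identityʳ _))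
  supersets-pascal {suc n} {suc s} (suc k) (s≤s s≤n) = supersets-pascal k s≤n

  supersets-factorial : ∀ {n s k} → s ≤ n → k ≤ n →
                        supersets n s k * (k ! * (n ∸ k) !) ≡ (n ∸ s) ! * s ! * (k C s)
  supersets-factorial {n} {zero} {k} _ k≤n =
    trans (C-factorial k≤n) (sym (trans (ℕₚ.*-identityʳ (n ! * 1)) (ℕₚ.*-identityʳ (n !))))
  supersets-factorial {suc n} {suc s} {zero} _ _ = sym (ℕₚ.*-zeroʳ ((n ∸ s) ! * suc s !))
  supersets-factorial {suc n} {suc s} {suc k} (s≤s s≤n) (s≤s k≤n) = begin
    supersets n s k * (suc k ! * (n ∸ k) !)       ≡⟨ pull (supersets n s k) k (k !) ((n ∸ k) !) ⟩
    suc k * (supersets n s k * (k ! * (n ∸ k) !)) ≡⟨ cong (suc k *_) (supersets-factorial s≤n k≤n) ⟩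
    suc k * ((n ∸ s) ! * s ! * (k C s))           ≡⟨ push k ((n ∸ s) !) (s !) (k C s) ⟩
    (n ∸ s) ! * s ! * (suc k * (k C s))           ≡⟨ cong ((n ∸ s) ! * s ! *_) (C-absorption k s) ⟨
    (n ∸ s) ! * s ! * (suc s * (suc k C suc s))   ≡⟨ regroup ((n ∸ s) !) s (s !) (suc k C suc s) ⟩
    (n ∸ s) ! * suc s ! * (suc k C suc s)         ∎
    where
    pull : ∀ b k f r → b * ((1 + k) * f * r) ≡ (1 + k) * (b * (f * r))
    pull = solve-∀
    push : ∀ k a f c → (1 + k) * (a * f * c) ≡ a * f * ((1 + k) * c)
    push = solve-∀
    regroup : ∀ a s f c → a * f * ((1 + s) * c) ≡ a * ((1 + s) * f) * c
    regroup = solve-∀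

open Binomials

module Weights where

  open import Data.Fin using (fromℕ)
  open import Data.Fin.Properties using (toℕ-fromℕ; suc-injective)
  open import Data.Nat using (_+_; _*_)
  open import Data.Vec.Functional using (tail)
  open ≡-Reasoning

  weight-step : ∀ {n} {x y : Cube n} → Step x y → weight y ≡ suc (weight x)
  weight-step {suc n} {x} {y} (zero , x₀≡0 , y₀≡1 , same) = begin
    weight y
      ≡⟨ cong₂ (λ b w → b2n b + w) y₀≡1 (sumFinℕ-cong λ j → cong b2n (sym (same (suc j) λ ()))) ⟩
    suc (weight (tail x))
      ≡⟨ cong (λ b → suc (b2n b + weight (tail x))) x₀≡0 ⟨
    suc (weight x)
      ∎
  weight-step {suc n} {x} {y} (suc i , xᵢ≡0 , yᵢ≡1 , same) = begin
    weight y                             ≡⟨ cong₂ (λ b w → b2n b + w) (sym (same zero λ ())) (weight-step step) ⟩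
    b2n (x zero) + suc (weight (tail x)) ≡⟨ ℕₚ.+-suc (b2n (x zero)) _ ⟩
    suc (weight x)                       ∎
    where
    step : Step (tail x) (tail y)
    step = i , xᵢ≡0 , yᵢ≡1 , λ j j≢i → same (suc j) (j≢i ∘ suc-injective)

  weight-all : ∀ {n} b {x : Cube n} → (∀ i → x i ≡ b) → weight x ≡ n * b2n b
  weight-all {n} b x≡b = trans (sumFinℕ-cong (cong b2n ∘ x≡b)) (sumFinℕ-const n (b2n b))

  weight-along : ∀ {n} m (P : Fin (suc m) → Cube n) → (∀ k → Step (P (inject₁ k)) (P (suc k))) →
                 ∀ k → weight (P k) ≡ toℕ k + weight (P zero)
  weight-along m       P steps zero    = refl
  weight-along (suc m) P steps (suc k) = begin
    weight (P (suc k))                ≡⟨ weight-along m (P ∘ suc) (steps ∘ suc) k ⟩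
    toℕ k + weight (P (suc zero))     ≡⟨ cong (toℕ k +_) (weight-step (steps zero)) ⟩
    toℕ k + suc (weight (P zero))     ≡⟨ ℕₚ.+-suc (toℕ k) _ ⟩
    suc (toℕ k + weight (P zero))     ∎

  path-weight : ∀ {n m} (P : Fin (suc m) → Cube n) → MonotonePath m P → ∀ k → weight (P k) ≡ toℕ k
  path-weight {n} {m} P (starts , _ , steps) k = begin
    weight (P k)                ≡⟨ weight-along m P steps k ⟩
    toℕ k + weight (P zero)     ≡⟨ cong (toℕ k +_) (trans (weight-all false starts) (ℕₚ.*-zeroʳ n)) ⟩
    toℕ k + 0                   ≡⟨ ℕₚ.+-identityʳ (toℕ k) ⟩
    toℕ k                       ∎

  path-length : ∀ {n m} (P : Fin (suc m) → Cube n) → MonotonePath m P → m ≡ n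
  path-length {n} {m} P path@(_ , ends , _) = begin
    m                    ≡⟨ toℕ-fromℕ m ⟨
    toℕ (fromℕ m)        ≡⟨ path-weight P path (fromℕ m) ⟨
    weight (P (fromℕ m)) ≡⟨ weight-all true ends ⟩
    n * 1                ≡⟨ ℕₚ.*-identityʳ n ⟩
    n                    ∎

open Weights

changes : ∀ m → (Fin (suc m) → Bool) → ℕ
changes m s = sumFinℕ m (λ k → b2n (s (inject₁ k) xor s (suc k)))

support : ∀ {n} → (Fin n → ℕ) → ℕ
support {n} e = sumFinℕ n (λ i → 1 ℕ.⊓ e i)

support≤n : ∀ {n} (e : Fin n → ℕ) → support e ℕ.≤ n
support≤n {n} e = ℕₚ.≤-trans (sumFinℕ-mono (λ i → ℕₚ.m⊓n≤m 1 (e i)))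
                             (ℕₚ.≤-reflexive (trans (sumFinℕ-const n 1) (ℕₚ.*-identityʳ n)))

support≤degree : ∀ {n} (e : Fin n → ℕ) → support e ℕ.≤ sumFinℕ n e
support≤degree e = sumFinℕ-mono (λ i → ℕₚ.m⊓n≤n 1 (e i))

support-0 : ∀ n → support {n} (λ _ → 0) ≡ 0
support-0 n = trans (sumFinℕ-const n 0) (ℕₚ.*-zeroʳ n)

module _ (R : RealNumbers) where

  open import Algebra.Bundles using (CommutativeRing)
  import Algebra.Properties.Semiring.Mult
  open import Algebra.Properties.CommutativeSemigroup using (interchange; x∙yz≈y∙xz)
  open import Effect.Monad using (RawMonad)
  open import Level using (0ℓ)
  open import Relation.Binary.Structures using (IsTotalOrder)
  open import Relation.Nullary using (¬_)
  open import Relation.Nullary.Negation using (¬¬-Monad)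
  open import Relation.Nullary.Decidable using (¬¬-excluded-middle; toSum; decidable-stable)
  open import Data.Nat.Combinatorics using (nCk+nC[k+1]≡[n+1]C[k+1])
  open import Data.Fin.Properties using (toℕ≤pred[n])

  open RealNumbers R hiding (_≤_; +-mono-≤)
  open Poly R

  -- The field _≤_ has no fixity declaration; this copy binds looser than _+_ and _*_.
  private
    infix 4 _≤_
    _≤_ : ℝ → ℝ → Set
    _≤_ = RealNumbers._≤_ R

  ring : CommutativeRing 0ℓ 0ℓ
  ring = record { isCommutativeRing = isCommutativeRing }

  open CommutativeRing ring
    using (_-_; +-comm; +-identityˡ; +-identityʳ; -‿inverseʳ;
           *-assoc; *-identityˡ; *-identityʳ; distribˡ; distribʳ; zeroˡ; zeroʳ;
           +-commutativeSemigroup; *-commutativeSemigroup; semiring)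
  open import Algebra.Properties.Ring (CommutativeRing.ring ring)
    using (-0#≈0#; -‿involutive; -‿+-comm; -‿distribˡ-*; -‿distribʳ-*;
           //-rightDividesˡ; //-rightDividesʳ; x[y-z]≈xy-xz)
  module Mult = Algebra.Properties.Semiring.Mult semiring
  open IsTotalOrder isTotalOrder
    using (total; antisym) renaming (refl to ≤-refl; trans to ≤-trans)
  open RawMonad (¬¬-Monad {0ℓ}) using (pure; _>>=_; _<$>_)

  two : ℝ
  two = 1ℝ + 1ℝ

  fromℕ : ℕ → ℝ
  fromℕ m = m Mult.× 1ℝ

  -- Order

  +-monoˡ-≤ : ∀ {x y} z → x ≤ y → x + z ≤ y + z
  +-monoˡ-≤ = RealNumbers.+-mono-≤ R _ _

  +-monoʳ-≤ : ∀ {x y} z → x ≤ y → z + x ≤ z + y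
  +-monoʳ-≤ {x} {y} z x≤y = subst₂ _≤_ (+-comm x z) (+-comm y z) (+-monoˡ-≤ z x≤y)

  +-mono-≤ : ∀ {x y u v} → x ≤ y → u ≤ v → x + u ≤ y + v
  +-mono-≤ {y = y} {u} x≤y u≤v = ≤-trans (+-monoˡ-≤ u x≤y) (+-monoʳ-≤ y u≤v)

  +-cancelʳ-≤ : ∀ {x y} z → x + z ≤ y + z → x ≤ y
  +-cancelʳ-≤ {x} {y} z x+z≤y+z =
    subst₂ _≤_ (//-rightDividesʳ z x) (//-rightDividesʳ z y) (+-monoˡ-≤ (- z) x+z≤y+z)

  +-cancelˡ-≤ : ∀ {x y} z → z + x ≤ z + y → x ≤ y
  +-cancelˡ-≤ {x} {y} z z+x≤z+y = +-cancelʳ-≤ z (subst₂ _≤_ (+-comm z x) (+-comm z y) z+x≤z+y)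

  x≤y⇒0≤y-x : ∀ {x y} → x ≤ y → 0ℝ ≤ y - x
  x≤y⇒0≤y-x {x} {y} x≤y = subst (_≤ y - x) (-‿inverseʳ x) (+-monoˡ-≤ (- x) x≤y)

  0≤y-x⇒x≤y : ∀ {x y} → 0ℝ ≤ y - x → x ≤ y
  0≤y-x⇒x≤y {x} {y} 0≤y-x = subst₂ _≤_ (+-identityˡ x) (//-rightDividesˡ x y) (+-monoˡ-≤ x 0≤y-x)

  x-y≤0⇒x≤y : ∀ {x y} → x - y ≤ 0ℝ → x ≤ y
  x-y≤0⇒x≤y {x} {y} x-y≤0 = subst₂ _≤_ (//-rightDividesˡ y x) (+-identityˡ y) (+-monoˡ-≤ y x-y≤0)

  neg-antimono-≤ : ∀ {x y} → x ≤ y → - y ≤ - x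
  neg-antimono-≤ {x} {y} x≤y = 0≤y-x⇒x≤y (subst (0ℝ ≤_) reorder (x≤y⇒0≤y-x x≤y))
    where
    reorder : y - x ≡ - x - - y
    reorder = trans (+-comm y (- x)) (cong (- x +_) (sym (-‿involutive y)))

  *-monoˡ-≤-nonNeg : ∀ {x y} z → 0ℝ ≤ z → x ≤ y → z * x ≤ z * y
  *-monoˡ-≤-nonNeg {x} {y} z 0≤z x≤y =
    0≤y-x⇒x≤y (subst (0ℝ ≤_) (x[y-z]≈xy-xz z y x) (*-nonneg z (y - x) 0≤z (x≤y⇒0≤y-x x≤y)))

  0≤1 : 0ℝ ≤ 1ℝ
  0≤1 with total 0ℝ 1ℝ
  ... | inj₁ 0≤1 = 0≤1
  ... | inj₂ 1≤0 = ⊥-elim (0≢1 (antisym (subst (0ℝ ≤_) -1*-1≡1 (*-nonneg _ _ 0≤-1 0≤-1)) 1≤0))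
    where
    0≤-1 : 0ℝ ≤ - 1ℝ
    0≤-1 = subst (_≤ - 1ℝ) -0#≈0# (neg-antimono-≤ 1≤0)
    -1*-1≡1 : - 1ℝ * - 1ℝ ≡ 1ℝ
    -1*-1≡1 = trans (sym (-‿distribˡ-* 1ℝ (- 1ℝ))) (trans (cong -_ (*-identityˡ (- 1ℝ))) (-‿involutive 1ℝ))

  1≰0 : ¬ (1ℝ ≤ 0ℝ)
  1≰0 1≤0 = 0≢1 (antisym 0≤1 1≤0)

  0≤two : 0ℝ ≤ two
  0≤two = subst (_≤ two) (+-identityˡ 0ℝ) (+-mono-≤ 0≤1 0≤1)

  -x*-x≡x*x : ∀ x → - x * - x ≡ x * x
  -x*-x≡x*x x =
    trans (sym (-‿distribˡ-* x (- x))) (trans (cong -_ (sym (-‿distribʳ-* x x))) (-‿involutive (x * x)))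

  square≤1 : ∀ {y} → - 1ℝ ≤ y → y ≤ 1ℝ → y * y ≤ 1ℝ
  square≤1 {y} -1≤y y≤1 = case total 0ℝ y of λ where
      (inj₁ 0≤y) → nonNeg-square≤1 0≤y y≤1
      (inj₂ y≤0) → subst (_≤ 1ℝ) (-x*-x≡x*x y)
                     (nonNeg-square≤1 (subst (_≤ - y) -0#≈0# (neg-antimono-≤ y≤0))
                                      (subst (- y ≤_) (-‿involutive 1ℝ) (neg-antimono-≤ -1≤y)))
    where
    nonNeg-square≤1 : ∀ {z} → 0ℝ ≤ z → z ≤ 1ℝ → z * z ≤ 1ℝ
    nonNeg-square≤1 {z} 0≤z z≤1 = ≤-trans (subst (z * z ≤_) (*-identityʳ z) (*-monoˡ-≤-nonNeg z 0≤z z≤1)) z≤1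

  three≤square : ∀ {y} → three ≤ y → three ≤ y * y
  three≤square {y} three≤y = ≤-trans three≤y (subst (_≤ y * y) (*-identityʳ y) (*-monoˡ-≤-nonNeg y 0≤y 1≤y))
    where
    1≤y : 1ℝ ≤ y
    1≤y = ≤-trans (subst (_≤ three) (+-identityˡ 1ℝ) (+-monoˡ-≤ 1ℝ 0≤two)) three≤y
    0≤y : 0ℝ ≤ y
    0≤y = ≤-trans 0≤1 1≤y

  0≤three : 0ℝ ≤ three
  0≤three = subst (_≤ three) (+-identityˡ 0ℝ) (+-mono-≤ 0≤two 0≤1)

  three≤three* : ∀ {x} → 1ℝ ≤ x → three ≤ three * x
  three≤three* 1≤x = subst (_≤ three * _) (*-identityʳ three) (*-monoˡ-≤-nonNeg three 0≤three 1≤x)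

  three≤[3x]² : ∀ {x} → 1ℝ ≤ x ⊎ x ≤ - 1ℝ → three ≤ (three * x) * (three * x)
  three≤[3x]² {x} (inj₁ 1≤x)  = three≤square (three≤three* 1≤x)
  three≤[3x]² {x} (inj₂ x≤-1) = subst (three ≤_) (-x*-x≡x*x (three * x))
    (three≤square (subst (three ≤_) (sym (-‿distribʳ-* three x)) (three≤three* 1≤-x)))
    where
    1≤-x : 1ℝ ≤ - x
    1≤-x = subst (_≤ - x) (-‿involutive 1ℝ) (neg-antimono-≤ x≤-1)

  -- Sign true x is x > 0 and Sign false x is x < 0, each stated as the negation of the opposite weak
  -- inequality; with it excluded middle is only needed under a double negation.
  WeakSign : Bool → ℝ → Set
  WeakSign true  x = 0ℝ ≤ x
  WeakSign false x = x ≤ 0ℝ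

  Sign : Bool → ℝ → Set
  Sign b x = ¬ WeakSign (not b) x

  WeakSign-total : ∀ b x → WeakSign b x ⊎ WeakSign (not b) x
  WeakSign-total true  x = total 0ℝ x
  WeakSign-total false x = swap (total 0ℝ x)

  Sign⇒WeakSign : ∀ b {x} → Sign b x → WeakSign b x
  Sign⇒WeakSign b {x} s = [ id , ⊥-elim ∘ s ]′ (WeakSign-total b x)

  Sign-exclusive : ∀ b {x} → Sign b x → Sign (not b) x → ⊥
  Sign-exclusive true  s s' = s' (Sign⇒WeakSign true s)
  Sign-exclusive false s s' = s' (Sign⇒WeakSign false s)

  Sign-dichotomy : ∀ b x → ¬ ¬ (WeakSign b x ⊎ Sign (not b) x)
  Sign-dichotomy true  x = toSum <$> ¬¬-excluded-middle
  Sign-dichotomy false x = toSum <$> ¬¬-excluded-middle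

  WeakSign-0 : ∀ b → WeakSign b 0ℝ
  WeakSign-0 true  = ≤-refl
  WeakSign-0 false = ≤-refl

  ¬Sign-0 : ∀ b → ¬ Sign b 0ℝ
  ¬Sign-0 b s = s (WeakSign-0 (not b))

  WeakSign-+ : ∀ b {x y} → WeakSign b x → WeakSign b y → WeakSign b (x + y)
  WeakSign-+ true  0≤x 0≤y = subst (_≤ _) (+-identityˡ 0ℝ) (+-mono-≤ 0≤x 0≤y)
  WeakSign-+ false x≤0 y≤0 = subst (_ ≤_) (+-identityˡ 0ℝ) (+-mono-≤ x≤0 y≤0)

  Sign-+ : ∀ b {x y} → WeakSign b x → Sign b y → Sign b (x + y)
  Sign-+ true  {x} {y} 0≤x y≰0 x+y≤0 = y≰0 (≤-trans (subst (_≤ x + y) (+-identityˡ y) (+-monoˡ-≤ y 0≤x)) x+y≤0)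
  Sign-+ false {x} {y} x≤0 0≰y 0≤x+y = 0≰y (≤-trans 0≤x+y (subst (x + y ≤_) (+-identityˡ y) (+-monoˡ-≤ y x≤0)))

  fromℕ-suc-* : ∀ m x → fromℕ (suc m) * x ≡ x + fromℕ m * x
  fromℕ-suc-* m x = trans (distribʳ x 1ℝ (fromℕ m)) (cong (_+ fromℕ m * x) (*-identityˡ x))

  WeakSign-fromℕ-* : ∀ b {x} m → WeakSign b x → WeakSign b (fromℕ m * x)
  WeakSign-fromℕ-* b {x} zero    w = subst (WeakSign b) (sym (zeroˡ x)) (WeakSign-0 b)
  WeakSign-fromℕ-* b {x} (suc m) w =
    subst (WeakSign b) (sym (fromℕ-suc-* m x)) (WeakSign-+ b w (WeakSign-fromℕ-* b m w))

  Sign-fromℕ-* : ∀ b {x} m .{{_ : ℕ.NonZero m}} → Sign b x → Sign b (fromℕ m * x)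
  Sign-fromℕ-* b {x} (suc m) s =
    subst (Sign b) (trans (+-comm _ x) (sym (fromℕ-suc-* m x)))
      (Sign-+ b (WeakSign-fromℕ-* b m (Sign⇒WeakSign b s)) s)

  -- Finite differences and sign changes

  Δ : (ℕ → ℝ) → ℕ → ℝ
  Δ h k = h (suc k) - h k

  Δ^ : ℕ → (ℕ → ℝ) → ℕ → ℝ
  Δ^ zero    h = h
  Δ^ (suc j) h = Δ^ j (Δ h)

  Δ^-local : ∀ j {h h' c} → (∀ k → c ℕ.≤ k → k ℕ.≤ j ℕ.+ c → h k ≡ h' k) → Δ^ j h c ≡ Δ^ j h' c
  Δ^-local zero    {c = c} h≗h' = h≗h' c ℕₚ.≤-refl ℕₚ.≤-refl
  Δ^-local (suc j) h≗h' = Δ^-local j λ k c≤k k≤j+c →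
    cong₂ _-_ (h≗h' (suc k) (ℕₚ.m≤n⇒m≤1+n c≤k) (s≤s k≤j+c)) (h≗h' k c≤k (ℕₚ.m≤n⇒m≤1+n k≤j+c))

  Δ^-cong : ∀ j {h h'} → (∀ k → h k ≡ h' k) → ∀ c → Δ^ j h c ≡ Δ^ j h' c
  Δ^-cong j h≗h' c = Δ^-local j λ k _ _ → h≗h' k

  Δ^-+ : ∀ j h h' c → Δ^ j (λ k → h k + h' k) c ≡ Δ^ j h c + Δ^ j h' c
  Δ^-+ zero    h h' c = refl
  Δ^-+ (suc j) h h' c = trans (Δ^-cong j Δ-+ c) (Δ^-+ j (Δ h) (Δ h') c)
    where
    Δ-+ : ∀ k → Δ (λ k → h k + h' k) k ≡ Δ h k + Δ h' k
    Δ-+ k = trans (cong (h (suc k) + h' (suc k) +_) (sym (-‿+-comm (h k) (h' k))))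
                  (interchange +-commutativeSemigroup (h (suc k)) (h' (suc k)) (- h k) (- h' k))

  Δ^-* : ∀ j a h c → Δ^ j (λ k → a * h k) c ≡ a * Δ^ j h c
  Δ^-* zero    a h c = refl
  Δ^-* (suc j) a h c = trans (Δ^-cong j (λ k → sym (x[y-z]≈xy-xz a (h (suc k)) (h k))) c) (Δ^-* j a (Δ h) c)

  Δ^-0 : ∀ j {h} → (∀ k → h k ≡ 0ℝ) → ∀ c → Δ^ j h c ≡ 0ℝ
  Δ^-0 zero    h≗0 = h≗0
  Δ^-0 (suc j) h≗0 = Δ^-0 j λ k → trans (cong₂ _-_ (h≗0 (suc k)) (h≗0 k)) (-‿inverseʳ 0ℝ)

  Δ^-binomial : ∀ {s j} → s ℕ.< j → ∀ c → Δ^ j (λ k → fromℕ (k C s)) c ≡ 0ℝ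
  Δ^-binomial {zero}  {suc j} _ = Δ^-0 j λ k → -‿inverseʳ (fromℕ 1)
  Δ^-binomial {suc s} {suc j} (s≤s s<j) c = trans (Δ^-cong j Δ-binomial c) (Δ^-binomial s<j c)
    where
    Δ-binomial : ∀ k → Δ (λ k → fromℕ (k C suc s)) k ≡ fromℕ (k C s)
    Δ-binomial k = begin
      fromℕ (suc k C suc s) - fromℕ (k C suc s)
        ≡⟨ cong (λ m → fromℕ m - fromℕ (k C suc s)) (nCk+nC[k+1]≡[n+1]C[k+1] k s) ⟨
      fromℕ ((k C s) ℕ.+ (k C suc s)) - fromℕ (k C suc s)
        ≡⟨ cong (_- fromℕ (k C suc s)) (Mult.×-homo-+ 1ℝ (k C s) (k C suc s)) ⟩
      fromℕ (k C s) + fromℕ (k C suc s) - fromℕ (k C suc s)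
        ≡⟨ //-rightDividesʳ (fromℕ (k C suc s)) (fromℕ (k C s)) ⟩
      fromℕ (k C s)
        ∎
      where open ≡-Reasoning

  -- SignChanges h b j a e: positions a = a₀ < a₁ < ⋯ < e at which h has strict signs, starting
  -- with sign b, where exactly j consecutive pairs have opposite signs.
  data SignChanges (h : ℕ → ℝ) : Bool → ℕ → ℕ → ℕ → Set where
    [_]    : ∀ {b a} → Sign b (h a) → SignChanges h b 0 a a
    keep   : ∀ {b j a a' e} → Sign b (h a) → a ℕ.< a' → SignChanges h b j a' e → SignChanges h b j a e
    switch : ∀ {b j a a' e} → Sign b (h a) → a ℕ.< a' → SignChanges h (not b) j a' e →
             SignChanges h b (suc j) a e

  module _ {h : ℕ → ℝ} where

    SignChanges-head : ∀ {b j a e} → SignChanges h b j a e → Sign b (h a)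
    SignChanges-head [ s ]          = s
    SignChanges-head (keep s _ _)   = s
    SignChanges-head (switch s _ _) = s

    SignChanges-start≤end : ∀ {b j a e} → SignChanges h b j a e → a ℕ.≤ e
    SignChanges-start≤end [ _ ]              = ℕₚ.≤-refl
    SignChanges-start≤end (keep _ a<a' rest)   = ℕₚ.≤-trans (ℕₚ.<⇒≤ a<a') (SignChanges-start≤end rest)
    SignChanges-start≤end (switch _ a<a' rest) = ℕₚ.≤-trans (ℕₚ.<⇒≤ a<a') (SignChanges-start≤end rest)

    SignChanges-shift : ∀ {b j a e} → SignChanges (h ∘ suc) b j a e → SignChanges h b j (suc a) (suc e)
    SignChanges-shift [ s ]               = [ s ]
    SignChanges-shift (keep s a<a' rest)   = keep s (s≤s a<a') (SignChanges-shift rest)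
    SignChanges-shift (switch s a<a' rest) = switch s (s≤s a<a') (SignChanges-shift rest)

    SignChanges-cons : ∀ {b₀ b₁ j a a' e} → Sign b₀ (h a) → a ℕ.< a' → SignChanges h b₁ j a' e →
                       SignChanges h b₀ (b2n (b₀ xor b₁) ℕ.+ j) a e
    SignChanges-cons {true}  {true}  = keep
    SignChanges-cons {true}  {false} = switch
    SignChanges-cons {false} {true}  = switch
    SignChanges-cons {false} {false} = keep

    Sign-step : ∀ {b a} → Sign b (h a) → WeakSign b (Δ h a) → Sign b (h (suc a))
    Sign-step {b} {a} s w = subst (Sign b) (//-rightDividesˡ (h a) (h (suc a))) (Sign-+ b w s)

    discrete-Rolle : ∀ {b a a'} → a ℕ.< a' → Sign b (h a) → Sign (not b) (h a') →
             ¬ ¬ ∃ λ c → a ℕ.≤ c × c ℕ.< a' × Sign (not b) (Δ h c)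
    discrete-Rolle {b} {a' = a'} a<a' sa sa' = search (ℕₚ.≤⇒≤‴ a<a') sa
      where
      Found : ℕ → Set
      Found a = ¬ ¬ ∃ λ c → a ℕ.≤ c × c ℕ.< a' × Sign (not b) (Δ h c)
      search : ∀ {a} → a ℕ.<‴ a' → Sign b (h a) → Found a
      continue : ∀ {a} → a ℕ.<‴ a' → Sign b (h (suc a)) → Found a
      search {a} a<a' sa = Sign-dichotomy b (Δ h a) >>= λ where
        (inj₁ Δ-keeps)    → continue a<a' (Sign-step {b} sa Δ-keeps)
        (inj₂ Δ-switches) → pure (a , ℕₚ.≤-refl , ℕₚ.≤‴⇒≤ a<a' , Δ-switches)
      continue ℕ.≤‴-refl           s = ⊥-elim (Sign-exclusive b s sa')
      continue (ℕ.≤‴-step a+1<a') s = (λ (c , a<c , rest) → c , ℕₚ.<⇒≤ a<c , rest) <$> search a+1<a' s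

    Δ-SignChanges : ∀ {b j a e} → SignChanges h b (suc j) a e →
                    ¬ ¬ ∃₂ λ a' e' → SignChanges (Δ h) (not b) j a' e' × a ℕ.≤ a' × e' ℕ.< e
    Δ-SignChanges (keep _ a<a' rest) = do
      (a'' , e' , chain , a'≤a'' , e'<e) ← Δ-SignChanges rest
      pure (a'' , e' , chain , ℕₚ.≤-trans (ℕₚ.<⇒≤ a<a') a'≤a'' , e'<e)
    Δ-SignChanges {b} {j = zero} (switch s a<a' rest) = do
      (c , a≤c , c<a' , sc) ← discrete-Rolle {b} a<a' s (SignChanges-head rest)
      pure (c , c , [ sc ] , a≤c , ℕₚ.<-≤-trans c<a' (SignChanges-start≤end rest))
    Δ-SignChanges {b} {j = suc j} (switch s a<a' rest) = do
      (c , a≤c , c<a' , sc) ← discrete-Rolle {b} a<a' s (SignChanges-head rest)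
      (a'' , e' , chain , a'≤a'' , e'<e) ← Δ-SignChanges rest
      pure (c , e' , switch sc (ℕₚ.<-≤-trans c<a' a'≤a'') chain , a≤c , e'<e)

  Δ^-SignChanges : ∀ i {h b j a e} → SignChanges h b (i ℕ.+ j) a e →
                   ¬ ¬ ∃₂ λ b' c → i ℕ.+ c ℕ.≤ e × Sign b' (Δ^ i h c)
  Δ^-SignChanges zero {b = b} {a = a} chain =
    pure (b , a , SignChanges-start≤end chain , SignChanges-head chain)
  Δ^-SignChanges (suc i) chain = do
    (_ , e' , chain' , _ , e'<e) ← Δ-SignChanges chain
    (b' , c , i+c≤e' , s) ← Δ^-SignChanges i chain'
    pure (b' , c , ℕₚ.≤-trans (s≤s i+c≤e') e'<e , s)

  SignChanges≤degree : ∀ {D N h b j a e} → (∀ c → suc D ℕ.+ c ℕ.≤ N → Δ^ (suc D) h c ≡ 0ℝ) →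
                       SignChanges h b j a e → e ℕ.≤ N → j ℕ.≤ D
  SignChanges≤degree {D} {j = j} Δ^h≡0 chain e≤N = decidable-stable (j ℕ.≤? D) λ j≰D →
    Δ^-SignChanges (suc D) (subst (λ j → SignChanges _ _ j _ _) (sym (ℕₚ.m+[n∸m]≡n (ℕₚ.≰⇒> j≰D))) chain)
      λ (b' , c , bound , s) → ¬Sign-0 b' (subst (Sign b') (Δ^h≡0 c (ℕₚ.≤-trans bound e≤N)) s)

  signs⇒SignChanges : ∀ m {h} (s : Fin (suc m) → Bool) → (∀ k → Sign (s k) (h (toℕ k))) →
                      SignChanges h (s zero) (changes m s) 0 m
  signs⇒SignChanges zero    s signs = [ signs zero ]
  signs⇒SignChanges (suc m) s signs =
    SignChanges-cons (signs zero) (s≤s z≤n) (SignChanges-shift (signs⇒SignChanges m (s ∘ suc) (signs ∘ suc)))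

  -- Symmetrisation

  -- levelSum n g k = Σ_{|x| = k} g x.
  levelSum : ∀ n → (Cube n → ℝ) → ℕ → ℝ
  levelSum zero    g zero    = g Vec.[]
  levelSum zero    g (suc k) = 0ℝ
  levelSum (suc n) g zero    = levelSum n (g ∘ (false Vec.∷_)) zero
  levelSum (suc n) g (suc k) = levelSum n (g ∘ (false Vec.∷_)) (suc k) + levelSum n (g ∘ (true Vec.∷_)) k

  levelSum-cong : ∀ n {g g'} → (∀ x → g x ≡ g' x) → ∀ k → levelSum n g k ≡ levelSum n g' k
  levelSum-cong zero    g≗g' zero    = g≗g' Vec.[]
  levelSum-cong zero    g≗g' (suc k) = refl
  levelSum-cong (suc n) g≗g' zero    = levelSum-cong n (g≗g' ∘ (false Vec.∷_)) zero
  levelSum-cong (suc n) g≗g' (suc k) =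
    cong₂ _+_ (levelSum-cong n (g≗g' ∘ (false Vec.∷_)) (suc k)) (levelSum-cong n (g≗g' ∘ (true Vec.∷_)) k)

  levelSum-+ : ∀ n g g' k → levelSum n (λ x → g x + g' x) k ≡ levelSum n g k + levelSum n g' k
  levelSum-+ zero    g g' zero    = refl
  levelSum-+ zero    g g' (suc k) = sym (+-identityˡ 0ℝ)
  levelSum-+ (suc n) g g' zero    = levelSum-+ n _ _ zero
  levelSum-+ (suc n) g g' (suc k) =
    trans (cong₂ _+_ (levelSum-+ n _ _ (suc k)) (levelSum-+ n _ _ k)) (interchange +-commutativeSemigroup _ _ _ _)

  levelSum-* : ∀ n a g k → levelSum n (λ x → a * g x) k ≡ a * levelSum n g k
  levelSum-* zero    a g zero    = refl
  levelSum-* zero    a g (suc k) = sym (zeroʳ a)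
  levelSum-* (suc n) a g zero    = levelSum-* n a _ zero
  levelSum-* (suc n) a g (suc k) =
    trans (cong₂ _+_ (levelSum-* n a _ (suc k)) (levelSum-* n a _ k)) (sym (distribˡ a _ _))

  levelSum-WeakSign : ∀ n b g k → (∀ x → weight x ≡ k → WeakSign b (g x)) → WeakSign b (levelSum n g k)
  levelSum-WeakSign zero    b g zero    w = w Vec.[] refl
  levelSum-WeakSign zero    b g (suc k) w = WeakSign-0 b
  levelSum-WeakSign (suc n) b g zero    w = levelSum-WeakSign n b _ zero (w ∘ (false Vec.∷_))
  levelSum-WeakSign (suc n) b g (suc k) w =
    WeakSign-+ b (levelSum-WeakSign n b _ (suc k) (w ∘ (false Vec.∷_)))
                 (levelSum-WeakSign n b _ k λ x |x|≡k → w (true Vec.∷ x) (cong suc |x|≡k))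

  levelSum-Sign : ∀ n b g k → (∀ x → weight x ≡ k → Sign b (g x)) → k ℕ.≤ n → Sign b (levelSum n g k)
  levelSum-Sign zero    b g zero    s _         = s Vec.[] refl
  levelSum-Sign (suc n) b g zero    s _         = levelSum-Sign n b _ zero (s ∘ (false Vec.∷_)) z≤n
  levelSum-Sign (suc n) b g (suc k) s (s≤s k≤n) =
    Sign-+ b (levelSum-WeakSign n b _ (suc k) λ x |x|≡k+1 → Sign⇒WeakSign b (s (false Vec.∷ x) |x|≡k+1))
             (levelSum-Sign n b _ k (λ x |x|≡k → s (true Vec.∷ x) (cong suc |x|≡k)) k≤n)

  -- n! times the average of g over the level |x| = k; the factor k! (n - k)! = n! / C(n, k) avoids
  -- division.
  symmetrised : ∀ n → (Cube n → ℝ) → ℕ → ℝ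
  symmetrised n g k = fromℕ (k ! ℕ.* (n ∸ k) !) * levelSum n g k

  symmetrised-Sign : ∀ n b g k → (∀ x → weight x ≡ k → Sign b (g x)) → k ℕ.≤ n → Sign b (symmetrised n g k)
  symmetrised-Sign n b g k s k≤n =
    Sign-fromℕ-* b (k ! ℕ.* (n ∸ k) !) {{ℕₚ._!*_!≢0 k (n ∸ k)}} (levelSum-Sign n b g k s k≤n)

  monomial : ∀ {n} → (Fin n → ℕ) → Cube n → ℝ
  monomial {n} e x = prodFin n (λ i → pow (b2r (x i)) (e i))

  pow-1 : ∀ m → pow 1ℝ m ≡ 1ℝ
  pow-1 zero    = refl
  pow-1 (suc m) = trans (*-identityˡ _) (pow-1 m)

  prodFin-* : ∀ n a b → prodFin n a * prodFin n b ≡ prodFin n (λ i → a i * b i)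
  prodFin-* zero    a b = *-identityˡ 1ℝ
  prodFin-* (suc n) a b = trans (interchange *-commutativeSemigroup (a zero) _ (b zero) _)
                                (cong (a zero * b zero *_) (prodFin-* n (a ∘ suc) (b ∘ suc)))

  pow-+ : ∀ x m m' → pow x m * pow x m' ≡ pow x (m ℕ.+ m')
  pow-+ x zero    m' = *-identityˡ (pow x m')
  pow-+ x (suc m) m' = trans (*-assoc x (pow x m) (pow x m')) (cong (x *_) (pow-+ x m m'))

  monomial-* : ∀ {n} (e e' : Fin n → ℕ) x → monomial e x * monomial e' x ≡ monomial (λ i → e i ℕ.+ e' i) x
  monomial-* {n} e e' x = trans (prodFin-* n _ _) (prodFin-cong n λ i → pow-+ (b2r (x i)) (e i) (e' i))
    where
    prodFin-cong : ∀ n {a b} → (∀ i → a i ≡ b i) → prodFin n a ≡ prodFin n b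
    prodFin-cong zero    a≗b = refl
    prodFin-cong (suc n) a≗b = cong₂ _*_ (a≗b zero) (prodFin-cong n (a≗b ∘ suc))

  levelSum-monomial : ∀ n e k → levelSum n (monomial e) k ≡ fromℕ (supersets n (support e) k)
  levelSum-monomial zero    e zero    = sym (+-identityʳ 1ℝ)
  levelSum-monomial zero    e (suc k) = refl
  levelSum-monomial (suc n) e         = first-exponent (e zero)
    where
    open ≡-Reasoning
    e' = e ∘ suc
    s' = support e'

    scaled : ∀ a k → levelSum n (λ x → a * monomial e' x) k ≡ a * fromℕ (supersets n s' k)
    scaled a k = trans (levelSum-* n a (monomial e') k) (cong (a *_) (levelSum-monomial n e' k))

    vanishes : ∀ t y → 0ℝ * pow 0ℝ t * y ≡ 0ℝ
    vanishes t y = trans (cong (_* y) (zeroˡ (pow 0ℝ t))) (zeroˡ y)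

    unit : ∀ t y → 1ℝ * pow 1ℝ t * y ≡ y
    unit t y = trans (cong (_* y) (trans (*-identityˡ (pow 1ℝ t)) (pow-1 t))) (*-identityˡ y)

    first-exponent : ∀ t k → levelSum (suc n) (monomial (t Vec.∷ e')) k ≡
                             fromℕ (supersets (suc n) (support (t Vec.∷ e')) k)
    first-exponent zero zero = begin
      levelSum n (λ x → 1ℝ * monomial e' x) 0 ≡⟨ trans (scaled 1ℝ 0) (*-identityˡ _) ⟩
      fromℕ (supersets n s' 0)                ≡⟨ cong fromℕ (supersets-zero n s') ⟨
      fromℕ (supersets (suc n) s' 0)          ∎
    first-exponent zero (suc k) = begin
      levelSum n (λ x → 1ℝ * monomial e' x) (suc k) + levelSum n (λ x → 1ℝ * monomial e' x) k
        ≡⟨ cong₂ _+_ (trans (scaled 1ℝ (suc k)) (*-identityˡ _)) (trans (scaled 1ℝ k) (*-identityˡ _)) ⟩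
      fromℕ (supersets n s' (suc k)) + fromℕ (supersets n s' k)
        ≡⟨ Mult.×-homo-+ 1ℝ (supersets n s' (suc k)) (supersets n s' k) ⟨
      fromℕ (supersets n s' (suc k) ℕ.+ supersets n s' k)
        ≡⟨ cong fromℕ (supersets-pascal k (support≤n e')) ⟨
      fromℕ (supersets (suc n) s' (suc k))
        ∎
    first-exponent (suc t) zero = trans (scaled (0ℝ * pow 0ℝ t) 0) (vanishes t _)
    first-exponent (suc t) (suc k) = begin
      levelSum n (λ x → 0ℝ * pow 0ℝ t * monomial e' x) (suc k) +
      levelSum n (λ x → 1ℝ * pow 1ℝ t * monomial e' x) k
        ≡⟨ cong₂ _+_ (trans (scaled (0ℝ * pow 0ℝ t) (suc k)) (vanishes t _))
                     (trans (scaled (1ℝ * pow 1ℝ t) k) (unit t _)) ⟩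
      0ℝ + fromℕ (supersets n s' k)
        ≡⟨ +-identityˡ _ ⟩
      fromℕ (supersets n s' k)
        ∎

  module _ (n : ℕ) where

    private
      weight-factor : ℕ → ℝ
      weight-factor k = fromℕ (k ! ℕ.* (n ∸ k) !)

    symmetrised-cong : ∀ {g g'} → (∀ x → g x ≡ g' x) → ∀ k → symmetrised n g k ≡ symmetrised n g' k
    symmetrised-cong g≗g' k = cong (weight-factor k *_) (levelSum-cong n g≗g' k)

    symmetrised-+ : ∀ g g' k → symmetrised n (λ x → g x + g' x) k ≡ symmetrised n g k + symmetrised n g' k
    symmetrised-+ g g' k =
      trans (cong (weight-factor k *_) (levelSum-+ n g g' k)) (distribˡ (weight-factor k) _ _)

    symmetrised-* : ∀ a g k → symmetrised n (λ x → a * g x) k ≡ a * symmetrised n g k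
    symmetrised-* a g k =
      trans (cong (weight-factor k *_) (levelSum-* n a g k))
            (x∙yz≈y∙xz *-commutativeSemigroup (weight-factor k) a _)

  symmetrised-monomial : ∀ {n} e {k} → k ℕ.≤ n →
    symmetrised n (monomial e) k ≡ fromℕ ((n ∸ support e) ! ℕ.* support e !) * fromℕ (k C support e)
  symmetrised-monomial {n} e {k} k≤n = begin
    fromℕ w * levelSum n (monomial e) k        ≡⟨ cong (fromℕ w *_) (levelSum-monomial n e k) ⟩
    fromℕ w * fromℕ (supersets n s k)          ≡⟨ Mult.×1-homo-* w (supersets n s k) ⟨
    fromℕ (w ℕ.* supersets n s k)              ≡⟨ cong fromℕ (ℕₚ.*-comm w (supersets n s k)) ⟩
    fromℕ (supersets n s k ℕ.* w)              ≡⟨ cong fromℕ (supersets-factorial (support≤n e) k≤n) ⟩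
    fromℕ ((n ∸ s) ! ℕ.* s ! ℕ.* (k C s))      ≡⟨ Mult.×1-homo-* ((n ∸ s) ! ℕ.* s !) (k C s) ⟩
    fromℕ ((n ∸ s) ! ℕ.* s !) * fromℕ (k C s)  ∎
    where
    open ≡-Reasoning
    s = support e
    w = k ! ℕ.* (n ∸ k) !

  -- LowDegree D g: the symmetrisation of g agrees on 0, …, n with a polynomial of degree ≤ D in k,
  -- expressed by the vanishing of its (D+1)-st differences.
  LowDegree : ∀ {n} → ℕ → (Cube n → ℝ) → Set
  LowDegree {n} D g = ∀ c → suc D ℕ.+ c ℕ.≤ n → Δ^ (suc D) (symmetrised n g) c ≡ 0ℝ

  module _ {n D : ℕ} where

    LowDegree-cong : ∀ {g g' : Cube n → ℝ} → (∀ x → g x ≡ g' x) → LowDegree D g → LowDegree D g'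
    LowDegree-cong g≗g' low c bound =
      trans (Δ^-cong (suc D) (symmetrised-cong n (sym ∘ g≗g')) c) (low c bound)

    LowDegree-+ : ∀ {g g' : Cube n → ℝ} → LowDegree D g → LowDegree D g' → LowDegree D (λ x → g x + g' x)
    LowDegree-+ {g} {g'} low low' c bound = begin
      Δ^ (suc D) (symmetrised n (λ x → g x + g' x)) c
        ≡⟨ Δ^-cong (suc D) (symmetrised-+ n g g') c ⟩
      Δ^ (suc D) (λ k → symmetrised n g k + symmetrised n g' k) c
        ≡⟨ Δ^-+ (suc D) (symmetrised n g) (symmetrised n g') c ⟩
      Δ^ (suc D) (symmetrised n g) c + Δ^ (suc D) (symmetrised n g') c
        ≡⟨ cong₂ _+_ (low c bound) (low' c bound) ⟩
      0ℝ + 0ℝ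
        ≡⟨ +-identityˡ 0ℝ ⟩
      0ℝ ∎
      where open ≡-Reasoning

    LowDegree-scale : ∀ a {g : Cube n → ℝ} → LowDegree D g → LowDegree D (λ x → a * g x)
    LowDegree-scale a {g} low c bound = begin
      Δ^ (suc D) (symmetrised n (λ x → a * g x)) c
        ≡⟨ Δ^-cong (suc D) (symmetrised-* n a g) c ⟩
      Δ^ (suc D) (λ k → a * symmetrised n g k) c
        ≡⟨ Δ^-* (suc D) a (symmetrised n g) c ⟩
      a * Δ^ (suc D) (symmetrised n g) c
        ≡⟨ cong (a *_) (low c bound) ⟩
      a * 0ℝ
        ≡⟨ zeroʳ a ⟩
      0ℝ ∎
      where open ≡-Reasoning

    LowDegree-monomial : ∀ e → support e ℕ.≤ D → LowDegree D (monomial e)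
    LowDegree-monomial e s≤D c bound = begin
      Δ^ (suc D) (symmetrised n (monomial e)) c
        ≡⟨ Δ^-local (suc D) (λ k _ k≤D+c → symmetrised-monomial e (ℕₚ.≤-trans k≤D+c bound)) ⟩
      Δ^ (suc D) (λ k → a * fromℕ (k C support e)) c
        ≡⟨ Δ^-* (suc D) a _ c ⟩
      a * Δ^ (suc D) (λ k → fromℕ (k C support e)) c
        ≡⟨ cong (a *_) (Δ^-binomial (s≤s s≤D) c) ⟩
      a * 0ℝ
        ≡⟨ zeroʳ a ⟩
      0ℝ ∎
      where
      open ≡-Reasoning
      a = fromℕ ((n ∸ support e) ! ℕ.* support e !)

    LowDegree-const : ∀ a → LowDegree D (λ _ → a)
    LowDegree-const a =
      LowDegree-cong (λ x → trans (cong (a *_) (prodFin-1 n)) (*-identityʳ a))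
        (LowDegree-scale a (LowDegree-monomial (λ _ → 0) (subst (ℕ._≤ D) (sym (support-0 n)) z≤n)))
      where
      prodFin-1 : ∀ n → prodFin n (λ _ → 1ℝ) ≡ 1ℝ
      prodFin-1 zero    = refl
      prodFin-1 (suc n) = trans (*-identityˡ _) (prodFin-1 n)

    LowDegree-monomial*poly : ∀ {d d'} (e : Fin n → ℕ) (q : Polynomial n) → sumFinℕ n e ℕ.≤ d →
                              DegreeAtMost q d' → d ℕ.+ d' ℕ.≤ D → LowDegree D (λ x → monomial e x * evalPoly q x)
    LowDegree-monomial*poly e []             _   _                d+d'≤D =
      LowDegree-cong (λ x → sym (zeroʳ (monomial e x))) (LowDegree-const 0ℝ)
    LowDegree-monomial*poly e ((c , e') ∷ q) e≤d (e'≤d' , q≤d') d+d'≤D =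
      LowDegree-cong expand
        (LowDegree-+ (LowDegree-scale c (LowDegree-monomial (λ i → e i ℕ.+ e' i) support≤D))
                     (LowDegree-monomial*poly e q e≤d q≤d' d+d'≤D))
      where
      expand : ∀ x → c * monomial (λ i → e i ℕ.+ e' i) x + monomial e x * evalPoly q x ≡
                     monomial e x * evalPoly ((c , e') ∷ q) x
      expand x = sym (trans (distribˡ (monomial e x) _ _)
                            (cong (_+ monomial e x * evalPoly q x)
                                  (trans (x∙yz≈y∙xz *-commutativeSemigroup (monomial e x) c _)
                                         (cong (c *_) (monomial-* e e' x)))))
      support≤D : support (λ i → e i ℕ.+ e' i) ℕ.≤ D
      support≤D = ℕₚ.≤-trans (support≤degree (λ i → e i ℕ.+ e' i))
                    (ℕₚ.≤-trans (ℕₚ.≤-reflexive (sumFinℕ-+ e e')) (ℕₚ.≤-trans (ℕₚ.+-mono-≤ e≤d e'≤d') d+d'≤D))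

    LowDegree-poly*poly : ∀ {d d'} (p q : Polynomial n) → DegreeAtMost p d → DegreeAtMost q d' →
                          d ℕ.+ d' ℕ.≤ D → LowDegree D (λ x → evalPoly p x * evalPoly q x)
    LowDegree-poly*poly []             q _           q≤d' d+d'≤D =
      LowDegree-cong (λ x → sym (zeroˡ (evalPoly q x))) (LowDegree-const 0ℝ)
    LowDegree-poly*poly ((c , e) ∷ p) q (e≤d , p≤d) q≤d' d+d'≤D =
      LowDegree-cong expand
        (LowDegree-+ (LowDegree-scale c (LowDegree-monomial*poly e q e≤d q≤d' d+d'≤D))
                     (LowDegree-poly*poly p q p≤d q≤d' d+d'≤D))
      where
      expand : ∀ x → c * (monomial e x * evalPoly q x) + evalPoly p x * evalPoly q x ≡
                     evalPoly ((c , e) ∷ p) x * evalPoly q x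
      expand x =
        sym (trans (distribʳ (evalPoly q x) _ _) (cong (_+ evalPoly p x * evalPoly q x) (*-assoc c _ _)))

  SignRepresents : ∀ {n} → (Cube n → Bool) → (Cube n → ℝ) → Set
  SignRepresents f g = ∀ x → Sign (f x) (g x)

  -- (3p)² ≤ 1 where f = 0 and (3p)² ≥ 9 where f = 1, so subtracting 2 separates the two.
  separator : ∀ {n} → Polynomial n → Cube n → ℝ
  separator p x = (three * evalPoly p x) * (three * evalPoly p x) - two

  separator-SignRepresents : ∀ {n} {f : Cube n → Bool} p → NRepresents f p → SignRepresents f (separator p)
  separator-SignRepresents {f = f} p represents x with f x in fx
  ... | false = λ 0≤q → 1≰0 (+-cancelʳ-≤ 1ℝ (≤-trans (0≤y-x⇒x≤y 0≤q) y²≤0+1))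
    where
    y = three * evalPoly p x
    y²≤0+1 : y * y ≤ 0ℝ + 1ℝ
    y²≤0+1 = subst (y * y ≤_) (sym (+-identityˡ 1ℝ))
               (square≤1 (proj₁ (proj₁ (represents x) fx)) (proj₂ (proj₁ (represents x) fx)))
  ... | true = λ q≤0 →
    1≰0 (+-cancelˡ-≤ two (≤-trans (three≤[3x]² (proj₂ (represents x) fx)) (y²≤two+0 q≤0)))
    where
    y = three * evalPoly p x
    y²≤two+0 : y * y - two ≤ 0ℝ → y * y ≤ two + 0ℝ
    y²≤two+0 q≤0 = subst (y * y ≤_) (sym (+-identityʳ two)) (x-y≤0⇒x≤y q≤0)

  LowDegree-separator : ∀ {n d} (p : Polynomial n) → DegreeAtMost p d → LowDegree (2 ℕ.* d) (separator p)
  LowDegree-separator {d = d} p p≤d =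
    LowDegree-cong expand
      (LowDegree-+ (LowDegree-scale (three * three) (LowDegree-poly*poly p p p≤d p≤d d+d≤2d))
                   (LowDegree-const (- two)))
    where
    expand : ∀ x → (three * three) * (evalPoly p x * evalPoly p x) - two ≡ separator p x
    expand x = cong (_- two) (sym (interchange *-commutativeSemigroup three (evalPoly p x) three (evalPoly p x)))
    d+d≤2d : d ℕ.+ d ℕ.≤ 2 ℕ.* d
    d+d≤2d = ℕₚ.≤-reflexive (cong (d ℕ.+_) (sym (ℕₚ.+-identityʳ d)))

  alternations≤degree : ∀ {n D m} {f : Cube n → Bool} {g : Cube n → ℝ} (P : Fin (suc m) → Cube n) →
                        Symmetric f → SignRepresents f g → LowDegree D g → MonotonePath m P →
                        alternations f m P ℕ.≤ D
  alternations≤degree {n} {D} {m} {f} {g} P symmetric represents low path =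
    SignChanges≤degree low (signs⇒SignChanges m (f ∘ P) level-Sign) (ℕₚ.≤-reflexive (path-length P path))
    where
    level-Sign : ∀ k → Sign (f (P k)) (symmetrised n g (toℕ k))
    level-Sign k = symmetrised-Sign n (f (P k)) g (toℕ k)
      (λ x |x|≡k → subst (λ b → Sign b (g x)) (symmetric x (P k) (trans |x|≡k (sym (path-weight P path k))))
                                              (represents x))
      (subst (toℕ k ℕ.≤_) (path-length P path) (toℕ≤pred[n] k))

open import Data.Nat using (_≤_; _*_)

lemma8 : (R : RealNumbers) (n : ℕ) (f : Cube n → Bool) → Symmetric f →
         (d : ℕ) (p : Poly.Polynomial R n) → Poly.DegreeAtMost R p d → Poly.NRepresents R f p →
         (m : ℕ) (P : Fin (suc m) → Cube n) → MonotonePath m P →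
         alternations f m P ≤ 2 * d
lemma8 R n f symmetric d p p≤d represents m P path =
  alternations≤degree R P symmetric (separator-SignRepresents R p represents) (LowDegree-separator R p p≤d) path
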